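{- Let $\langle \theta_\alpha:\alpha\le\omega\rangle$, $\langle \mathcal F_{\alpha,\beta}:\alpha<\beta\le\omega\rangle$ be a neat simplified $(\omega,1)$-morass. Then: (1) if $\alpha\le\beta\le\gamma<\omega$, then $\bigcup_{f\in\mathcal F_{\alpha,\gamma}}\mathrm{rng}(f)\subseteq\bigcup_{f\in\mathcal F_{\beta,\gamma}}\mathrm{rng}(f)$; (2) the sequence $\langle\theta_\alpha\rangle_{\alpha<\omega}$ is strictly increasing and $\theta_\alpha\notin\bigcup_{f\in\mathcal F_{\alpha,\alpha+1}}\mathrm{rng}(f)$ for every $\alpha<\omega$; (3) for any $\alpha,\gamma<\omega$ and $1\le n<\omega$, if $\gamma-\alpha\ge n$ then $\left|\theta_\gamma\setminus\bigcup_{f\in\mathcal F_{\alpha,\gamma}}\mathrm{rng}(f)\right|\ge n$.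
   Context: A neat simplified $(\omega,1)$-morass is a system $\langle \theta_\alpha:\alpha\le\omega\rangle$, $\langle \mathcal F_{\alpha,\beta}:\alpha<\beta\le\omega\rangle$ such that: (1) for $\alpha<\omega$, $\theta_\alpha$ is a natural number $>0$, and $\theta_\omega=\omega_1$; (2) for $\alpha<\beta\le\omega$, $\mathcal F_{\alpha,\beta}$ is a set of order preserving functions from $\theta_\alpha$ to $\theta_\beta$ (ordinals identified with their sets of predecessors); (3) $\bigcup_{\alpha<\omega}\bigcup_{f\in\mathcal F_{\alpha,\omega}}f``\theta_\alpha=\omega_1$; (4) for all $\alpha<\beta<\gamma\le\omega$, $\mathcal F_{\alpha,\gamma}=\{f\circ g: g\in\mathcal F_{\alpha,\beta},\ f\in\mathcal F_{\beta,\gamma}\}$; (5) for all $\alpha<\omega$, $\mathcal F_{\alpha,\alpha+1}=\{\mathrm{id}_\alpha,h_\alpha\}$ where $\mathrm{id}_\alpha$ is the identity on $\theta_\alpha$ and $h_\alpha$ is such that there is a splitting point $k$ with $h_\alpha\restriction k=\mathrm{id}_\alpha\restriction k$ and $h_\alpha(k)>\theta_\alpha$; (6) for every $\beta_0,\beta_1<\omega$ and $f_l\in\mathcal F_{\beta_l,\omega}$ ($l<2$) there are $\gamma<\omega$ with $\beta_0,\beta_1<\gamma$, $g\in\mathcal F_{\gamma,\omega}$ and $f'_l\in\mathcal F_{\beta_l,\gamma}$ with $f_l=g\circ f'_l$ for $l<2$. In (1), when $\alpha=\beta$ the inclusion is trivial. -}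

module Defs where

open import Level using (0ℓ)
open import Data.Nat using (ℕ; zero; suc; _<_; _≤_)
open import Data.Fin using (Fin; toℕ)
open import Data.Product using (Σ; ∃; _×_; _,_)
open import Data.Sum using (_⊎_)
open import Relation.Binary.Core using (Rel)
open import Relation.Binary.PropositionalEquality using (_≡_)
open import Relation.Nullary using (¬_)

OrderPres : ∀ {m n} → (Fin m → Fin n) → Set
OrderPres {m} f = ∀ (x y : Fin m) → toℕ x < toℕ y → toℕ (f x) < toℕ (f y)

OrderPresTop : ∀ {m} {Ω : Set} → Rel Ω 0ℓ → (Fin m → Ω) → Set
OrderPresTop {m} _<Ω_ f = ∀ (x y : Fin m) → toℕ x < toℕ y → f x <Ω f y

-- Finite levels α < ω are natural numbers;
-- the top level ω has θ_ω = Ω (with strict order _<Ω_), standing for ω₁.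
-- F α β f   : f ∈ 𝓕_{α,β}   (only meaningful for α < β)
-- Ftop α f  : f ∈ 𝓕_{α,ω}
-- Sets of functions are predicates; equality of functions is pointwise.
record NeatMorass (Ω : Set) (_<Ω_ : Rel Ω 0ℓ) : Set₁ where
  field
    θ      : ℕ → ℕ
    θ-pos  : ∀ α → 0 < θ α
    F      : (α β : ℕ) → (Fin (θ α) → Fin (θ β)) → Set
    Ftop   : (α : ℕ) → (Fin (θ α) → Ω) → Set
    F-ord    : ∀ α β → α < β → ∀ f → F α β f → OrderPres f
    Ftop-ord : ∀ α f → Ftop α f → OrderPresTop _<Ω_ f
    cover  : ∀ (ξ : Ω) → Σ ℕ λ α → Σ (Fin (θ α) → Ω) λ f → Ftop α f × ∃ λ x → f x ≡ ξ
    comp-⊆ : ∀ α β γ → α < β → β < γ → ∀ g f → F α β g → F β γ f →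
               F α γ (λ x → f (g x))
    comp-⊇ : ∀ α β γ → α < β → β < γ → ∀ h → F α γ h →
               Σ (Fin (θ α) → Fin (θ β)) λ g → Σ (Fin (θ β) → Fin (θ γ)) λ f →
                 F α β g × F β γ f × (∀ x → h x ≡ f (g x))
    comp-top-⊆ : ∀ α β → α < β → ∀ g f → F α β g → Ftop β f →
               Ftop α (λ x → f (g x))
    comp-top-⊇ : ∀ α β → α < β → ∀ h → Ftop α h →
               Σ (Fin (θ α) → Fin (θ β)) λ g → Σ (Fin (θ β) → Ω) λ f →
                 F α β g × Ftop β f × (∀ x → h x ≡ f (g x))
    idm    : ∀ α → Fin (θ α) → Fin (θ (suc α))
    hm     : ∀ α → Fin (θ α) → Fin (θ (suc α))
    idm-id : ∀ α x → toℕ (idm α x) ≡ toℕ x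
    idm-∈  : ∀ α → F α (suc α) (idm α)
    hm-∈   : ∀ α → F α (suc α) (hm α)
    only   : ∀ α f → F α (suc α) f →
               (∀ x → f x ≡ idm α x) ⊎ (∀ x → f x ≡ hm α x)
    split  : ∀ α → Σ (Fin (θ α)) λ k →
               (∀ x → toℕ x < toℕ k → toℕ (hm α x) ≡ toℕ x)
               × θ α < toℕ (hm α k)
    amalg  : ∀ β₀ β₁ (f₀ : Fin (θ β₀) → Ω) (f₁ : Fin (θ β₁) → Ω) →
               Ftop β₀ f₀ → Ftop β₁ f₁ →
               Σ ℕ λ γ → β₀ < γ × β₁ < γ × Σ (Fin (θ γ) → Ω) λ g → Ftop γ g ×
                 Σ (Fin (θ β₀) → Fin (θ γ)) λ f₀' → Σ (Fin (θ β₁) → Fin (θ γ)) λ f₁' →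
                   F β₀ γ f₀' × F β₁ γ f₁' ×
                   (∀ x → f₀ x ≡ g (f₀' x)) × (∀ x → f₁ x ≡ g (f₁' x))

  -- m ∈ ⋃_{f ∈ 𝓕_{α,γ}} rng(f)  (for α < γ < ω);  for α = γ we use the
  -- convention 𝓕_{γ,γ} = {id}, so the union is all of θ_γ.
  InRng : ℕ → ℕ → ℕ → Set
  InRng α γ m = (α ≡ γ × m < θ γ)
              ⊎ Σ (Fin (θ α) → Fin (θ γ)) λ f → F α γ f × ∃ λ x → toℕ (f x) ≡ m

module Submission where

-- Proof idea.  Write Rng(α,γ) for ⋃_{f ∈ 𝓕_{α,γ}} rng(f) (the predicate InRng α γ).
--
-- * By (5), every f ∈ 𝓕_{α,α+1} is the identity or h_α, and h_α fixes all
--   points below its splitting point k while sending every x ≥ k above θ_α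
--   (h_α(k) > θ_α and h_α is order preserving).  Hence each f ∈ 𝓕_{α,α+1}
--   either fixes x or sends it above θ_α ("succ-dichotomy").  This yields
--   θ_α < θ_{α+1} and θ_α ∉ Rng(α,α+1), and, combined with the factorisation
--   (4), that a point m < θ_γ missed by Rng(α,γ) is still missed by Rng(α,γ+1).
-- * Factorisation (4) also shows Rng(α,γ) ⊆ Rng(β,γ) for α ≤ β ≤ γ.
-- * Consequently every θ_δ with α ≤ δ < γ lies outside Rng(α,γ): it is new at
--   level δ+1 and stays unreached afterwards.  Since θ is strictly increasing,
--   i ↦ θ_{i+α} (i < n ≤ γ - α) is an injective family of n points of θ_γ
--   outside Rng(α,γ), which is part (3).

open import Defs
open import Level using (0ℓ)
open import Data.Nat using (ℕ; suc; _<_; _≤_; _∸_; _+_; s≤s; z≤n)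
open import Data.Nat.Properties
open import Data.Fin using (Fin; toℕ; fromℕ<)
open import Data.Fin.Properties using (toℕ<n; toℕ-injective; toℕ-fromℕ<; fromℕ<-injective)
open import Data.Product using (Σ; _×_; _,_)
open import Data.Sum using (_⊎_; inj₁; inj₂)
open import Relation.Binary.Core using (Rel)
open import Relation.Binary.Structures using (IsStrictTotalOrder)
open import Relation.Binary.Definitions using (tri<; tri≈; tri>)
open import Relation.Binary.PropositionalEquality
  using (_≡_; refl; sym; trans; cong; subst)
open import Induction.WellFounded using (WellFounded)
open import Function.Definitions using (Injective)
open import Relation.Nullary using (¬_)
open import Data.Empty using (⊥; ⊥-elim)

strictMono⇒injective : (s : ℕ → ℕ) → (∀ {a b} → a < b → s a < s b) →
                       ∀ {a b} → s a ≡ s b → a ≡ b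
strictMono⇒injective s mono {a} {b} e with <-cmp a b
... | tri< a<b _ _ = ⊥-elim (<-irrefl e (mono a<b))
... | tri≈ _ a≡b _ = a≡b
... | tri> _ _ b<a = ⊥-elim (<-irrefl (sym e) (mono b<a))

offset-below : ∀ {i α γ} → i < γ ∸ α → i + α < γ
offset-below {i} {α} {γ} i<γ∸α =
  m≤o∸n⇒m+n≤o (suc i) (<⇒≤ (m∸n≢0⇒n<m γ∸α≢0)) i<γ∸α
  where
  γ∸α≢0 : ¬ (γ ∸ α ≡ 0)
  γ∸α≢0 e = <⇒≱ i<γ∸α (subst (_≤ i) (sym e) z≤n)

module Morass {Ω : Set} {_<Ω_ : Rel Ω 0ℓ} (M : NeatMorass Ω _<Ω_) where
  open NeatMorass M

  hm-ord : ∀ α → OrderPres (hm α)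
  hm-ord α = F-ord α (suc α) (n<1+n α) (hm α) (hm-∈ α)

  hm-dichotomy : ∀ α x → toℕ (hm α x) ≡ toℕ x ⊎ θ α < toℕ (hm α x)
  hm-dichotomy α x with split α
  ... | k , fixes , escapes with <-cmp (toℕ x) (toℕ k)
  ... | tri< x<k _ _ = inj₁ (fixes x x<k)
  ... | tri≈ _ x≡k _ = inj₂ (subst (λ y → θ α < toℕ (hm α y)) (sym (toℕ-injective x≡k)) escapes)
  ... | tri> _ _ k<x = inj₂ (<-trans escapes (hm-ord α k x k<x))

  succ-dichotomy : ∀ α f → F α (suc α) f → ∀ x → toℕ (f x) ≡ toℕ x ⊎ θ α < toℕ (f x)
  succ-dichotomy α f f∈ x with only α f f∈
  ... | inj₁ f≗id = inj₁ (trans (cong toℕ (f≗id x)) (idm-id α x))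
  ... | inj₂ f≗h  = subst (λ y → toℕ y ≡ toℕ x ⊎ θ α < toℕ y) (sym (f≗h x)) (hm-dichotomy α x)

  -- Part (2), first half: θ_α < θ_{α+1}, witnessed by h_α(k) > θ_α.
  θ-step : ∀ α → θ α < θ (suc α)
  θ-step α with split α
  ... | k , _ , escapes = <-trans escapes (toℕ<n (hm α k))

  θ-mono : ∀ {α β} → α < β → θ α < θ β
  θ-mono {α} {suc β} (s≤s α≤β) with m≤n⇒m<n∨m≡n α≤β
  ... | inj₁ α<β = <-trans (θ-mono α<β) (θ-step β)
  ... | inj₂ refl = θ-step α

  θ-fresh : ∀ α → ¬ InRng α (suc α) (θ α)
  θ-fresh α (inj₁ (α≡α+1 , _)) = <-irrefl α≡α+1 (n<1+n α)
  θ-fresh α (inj₂ (f , f∈ , x , fx≡θ)) with succ-dichotomy α f f∈ x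
  ... | inj₁ fixed  = <-irrefl (trans (sym fixed) fx≡θ) (toℕ<n x)
  ... | inj₂ higher = <-irrefl (sym fx≡θ) higher

  rng-antitone : ∀ α β γ → α ≤ β → β ≤ γ → ∀ m → InRng α γ m → InRng β γ m
  rng-antitone α β γ α≤β β≤γ m (inj₁ (α≡γ , m<θγ)) =
    inj₁ (≤-antisym β≤γ (subst (_≤ β) α≡γ α≤β) , m<θγ)
  rng-antitone α β γ α≤β β≤γ m (inj₂ (h , h∈ , x , hx≡m))
    with m≤n⇒m<n∨m≡n α≤β | m≤n⇒m<n∨m≡n β≤γ
  ... | inj₂ refl | _         = inj₂ (h , h∈ , x , hx≡m)
  ... | inj₁ _    | inj₂ refl = inj₁ (refl , subst (_< θ β) hx≡m (toℕ<n (h x)))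
  ... | inj₁ α<β  | inj₁ β<γ with comp-⊇ α β γ α<β β<γ h h∈
  ...   | g , f , _ , f∈ , h≗fg = inj₂ (f , f∈ , g x , trans (cong toℕ (sym (h≗fg x))) hx≡m)

  -- A point m < θ_γ outside Rng(α,γ) stays outside Rng(α,γ+1): a preimage
  -- through h = f ∘ g with f ∈ 𝓕_{γ,γ+1} would have to be fixed by f.
  unreached-persists : ∀ α γ → α < γ → ∀ m → m < θ γ →
                       ¬ InRng α γ m → ¬ InRng α (suc γ) m
  unreached-persists α γ α<γ m m<θγ m∉ (inj₁ (α≡γ+1 , _)) =
    <-irrefl α≡γ+1 (<-trans α<γ (n<1+n γ))
  unreached-persists α γ α<γ m m<θγ m∉ (inj₂ (h , h∈ , x , hx≡m))
    with comp-⊇ α γ (suc γ) α<γ (n<1+n γ) h h∈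
  ... | g , f , g∈ , f∈ , h≗fg = contradiction (succ-dichotomy γ f f∈ (g x))
    where
    fgx≡m : toℕ (f (g x)) ≡ m
    fgx≡m = trans (cong toℕ (sym (h≗fg x))) hx≡m

    contradiction : toℕ (f (g x)) ≡ toℕ (g x) ⊎ θ γ < toℕ (f (g x)) → ⊥
    contradiction (inj₁ fixed)  = m∉ (inj₂ (g , g∈ , x , trans (sym fixed) fgx≡m))
    contradiction (inj₂ higher) = <-asym m<θγ (subst (θ γ <_) fgx≡m higher)

  θ-unreached : ∀ α δ γ → α ≤ δ → δ < γ → ¬ InRng α γ (θ δ)
  θ-unreached α δ (suc γ) α≤δ (s≤s δ≤γ) with m≤n⇒m<n∨m≡n δ≤γ
  ... | inj₂ refl = λ r → θ-fresh δ (rng-antitone α δ (suc δ) α≤δ (n≤1+n δ) (θ δ) r)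
  ... | inj₁ δ<γ  = unreached-persists α γ (≤-<-trans α≤δ δ<γ) (θ δ) (θ-mono δ<γ)
                      (θ-unreached α δ γ α≤δ δ<γ)

  -- Part (3): the points θ_{i+α}, i < n, form n distinct points of θ_γ
  -- outside Rng(α,γ).
  many-unreached : ∀ α γ n → n ≤ γ ∸ α →
    Σ (Fin n → Fin (θ γ)) λ g → Injective _≡_ _≡_ g × (∀ i → ¬ InRng α γ (toℕ (g i)))
  many-unreached α γ n n≤γ∸α = point , point-injective , point-unreached
    where
    level<γ : (i : Fin n) → toℕ i + α < γ
    level<γ i = offset-below (<-≤-trans (toℕ<n i) n≤γ∸α)

    point : Fin n → Fin (θ γ)
    point i = fromℕ< (θ-mono (level<γ i))

    point-injective : Injective _≡_ _≡_ point
    point-injective {i} {j} e = toℕ-injective (+-cancelʳ-≡ α (toℕ i) (toℕ j)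
      (strictMono⇒injective θ θ-mono
        (fromℕ<-injective _ _ (θ-mono (level<γ i)) (θ-mono (level<γ j)) e)))

    point-unreached : ∀ i → ¬ InRng α γ (toℕ (point i))
    point-unreached i r = θ-unreached α (toℕ i + α) γ (m≤n+m α (toℕ i)) (level<γ i)
      (subst (InRng α γ) (toℕ-fromℕ< (θ-mono (level<γ i))) r)

lemma2p2 : (Ω : Set) (_<Ω_ : Rel Ω 0ℓ) → IsStrictTotalOrder _≡_ _<Ω_ → WellFounded _<Ω_ →
    (M : NeatMorass Ω _<Ω_) →
    let open NeatMorass M in
      (∀ α β γ → α ≤ β → β ≤ γ → ∀ m → InRng α γ m → InRng β γ m)
      × (∀ α → θ α < θ (suc α))
      × (∀ α → ¬ InRng α (suc α) (θ α))
      × (∀ α γ n → 1 ≤ n → n ≤ γ ∸ α →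
           Σ (Fin n → Fin (θ γ)) λ g → Injective _≡_ _≡_ g × (∀ i → ¬ InRng α γ (toℕ (g i))))
lemma2p2 Ω _<Ω_ _ _ M =
  rng-antitone , θ-step , θ-fresh , λ α γ n _ → many-unreached α γ n
  where open Morass M
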